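{- Let $e$ be a resource expression and let $r$ be a rigid expression with $r\lhd e$. Then $m(e)=\mathrm{Card}(\mathbb D(r))$.
   Context: Resource terms and monomials: $s,t ::= x\mid\lambda x.s\mid\langle s\rangle\bar t\mid s\oplus\bullet\mid\bullet\oplus s$, $\bar t::=[t_1,\dots,t_n]$ (finite multisets), up to $\alpha$-equivalence; resource expressions are terms or monomials. The multiplicity: $m(x)=1$; $m(\lambda x.s)=m(s\oplus\bullet)=m(\bullet\oplus s)=m(s)$; $m(\langle s\rangle\bar t)=m(s)m(\bar t)$; $m([t_1]^{n_1}\cdot\ldots\cdot[t_k]^{n_k})=\prod_{i=1}^kn_i!\,m(t_i)^{n_i}$ for pairwise distinct $t_i$ ($[t]^n$: $n$ copies of $t$; $\cdot$ multiset union). Rigid terms and monomials: $a,b,c ::= x\mid\lambda x.a\mid\langle a\rangle\vec b\mid a\oplus\bullet\mid\bullet\oplus a$, $\vec b::=(b_1,\dots,b_n)$ (finite lists); rigid expressions are rigid terms or monomials. $\underline r$ is the resource expression obtained from $r$ by replacing recursively each list by the multiset of its elements; $r\lhd e$ means $\underline r=e$. Permutation expressions: $\alpha,\gamma ::= \mathrm{id}_x\mid\lambda x.\alpha\mid\langle\gamma\rangle\tilde\delta\mid\alpha\oplus\bullet\mid\bullet\oplus\alpha$ and $\tilde\delta::=(\sigma,\alpha_1,\dots,\alpha_n)$ with $\sigma\in\mathfrak S_n$. The judgement $\epsilon:r\cong r'$: $\mathrm{id}_x:x\cong x$; $\lambda x.\alpha:\lambda x.a\cong\lambda x.a'$, $\alpha\oplus\bullet:a\oplus\bullet\cong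 a'\oplus\bullet$, $\bullet\oplus\alpha:\bullet\oplus a\cong\bullet\oplus a'$ whenever $\alpha:a\cong a'$; $\langle\gamma\rangle\tilde\delta:\langle c\rangle\vec d\cong\langle c'\rangle\vec d'$ whenever $\gamma:c\cong c'$ and $\tilde\delta:\vec d\cong\vec d'$; $(\sigma,\alpha_1,\dots,\alpha_n):(a_1,\dots,a_n)\cong(a'_1,\dots,a'_n)$ whenever $\alpha_i:a_i\cong a'_{\sigma(i)}$ for all $i$. $\mathbb D(r)$ is the set of $\epsilon$ with $\epsilon:r\cong r$ (a group under the structural composition, where on monomials $(\sigma',\alpha'_1,\dots,\alpha'_n)(\sigma,\alpha_1,\dots,\alpha_n)=(\sigma'\sigma,\alpha'_{\sigma(1)}\alpha_1,\dots,\alpha'_{\sigma(n)}\alpha_n)$). -}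

module Defs where

open import Data.Nat using (ℕ; _*_; _^_; _≤_; _!)
open import Data.Nat.ListAction using (product)
open import Data.Fin using (Fin)
open import Data.Vec using (Vec; lookup; toList)
open import Data.List using (List; []; _∷_; replicate; concatMap; map)
open import Data.List.Relation.Unary.All using (All)
open import Data.List.Relation.Unary.AllPairs using (AllPairs)
open import Data.Product using (Σ; _×_; _,_; proj₁; proj₂; ∃)
open import Relation.Nullary using (¬_)
open import Relation.Binary.PropositionalEquality using (_≡_)

-- Variables are de Bruijn indices, so
-- alpha-equivalence is syntactic identity.  Monomials (finite multisets)
-- are represented by lists, identified up to the relation _≈_ below
-- (recursive multiset equality), so resource expressions are the
-- _≈_-classes of RExp.

data RTm : Set where
  var : ℕ → RTm
  lam : RTm → RTm
  app : RTm → List RTm → RTm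
  inl : RTm → RTm                -- s ⊕ •
  inr : RTm → RTm                -- • ⊕ s

data RExp : Set where
  term : RTm → RExp
  mono : List RTm → RExp

mutual
  data _≈_ : RTm → RTm → Set where
    var : ∀ x → var x ≈ var x
    lam : ∀ {s s'} → s ≈ s' → lam s ≈ lam s'
    app : ∀ {s s' ts ts'} → s ≈ s' → ts ≈ₗ ts' → app s ts ≈ app s' ts'
    inl : ∀ {s s'} → s ≈ s' → inl s ≈ inl s'
    inr : ∀ {s s'} → s ≈ s' → inr s ≈ inr s'

  data _≈ₗ_ : List RTm → List RTm → Set where
    []    : [] ≈ₗ []
    _∷_   : ∀ {s s' ts ts'} → s ≈ s' → ts ≈ₗ ts' → (s ∷ ts) ≈ₗ (s' ∷ ts')
    swap  : ∀ s t ts → (s ∷ t ∷ ts) ≈ₗ (t ∷ s ∷ ts)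
    trans : ∀ {ts us vs} → ts ≈ₗ us → us ≈ₗ vs → ts ≈ₗ vs

data _≈E_ : RExp → RExp → Set where
  term : ∀ {s s'} → s ≈ s' → term s ≈E term s'
  mono : ∀ {ts ts'} → ts ≈ₗ ts' → mono ts ≈E mono ts'

-- For a multiset t̄ = [t₁]^{n₁} · … · [t_k]^{n_k} with the tᵢ pairwise
-- distinct (as resource terms, i.e. not ≈), m(t̄) = ∏ nᵢ! m(tᵢ)^{nᵢ}.
-- A block (t , n , k) stands for [t]^n with m(t) = k.

Block : Set
Block = RTm × ℕ × ℕ

blkTm : Block → RTm
blkTm b = proj₁ b

blkN : Block → ℕ
blkN b = proj₁ (proj₂ b)

blkM : Block → ℕ
blkM b = proj₂ (proj₂ b)

blocksList : List Block → List RTm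
blocksList = concatMap (λ b → replicate (blkN b) (blkTm b))

blocksMult : List Block → ℕ
blocksMult bs = product (map (λ b → (blkN b) ! * (blkM b ^ blkN b)) bs)

mutual
  data MultT : RTm → ℕ → Set where
    var : ∀ x → MultT (var x) 1
    lam : ∀ {s k} → MultT s k → MultT (lam s) k
    app : ∀ {s ts k l} → MultT s k → MultM ts l → MultT (app s ts) (k * l)
    inl : ∀ {s k} → MultT s k → MultT (inl s) k
    inr : ∀ {s k} → MultT s k → MultT (inr s) k

  data MultM : List RTm → ℕ → Set where
    blocks : ∀ {ts} (bs : List Block)
           → ts ≈ₗ blocksList bs
           → AllPairs (λ b b' → ¬ (blkTm b ≈ blkTm b')) bs
           → All (λ b → (1 ≤ blkN b) × MultT (blkTm b) (blkM b)) bs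
           → MultM ts (blocksMult bs)

data MultE : RExp → ℕ → Set where
  term : ∀ {s k} → MultT s k → MultE (term s) k
  mono : ∀ {ts k} → MultM ts k → MultE (mono ts) k

data Rigid : Set where
  var : ℕ → Rigid
  lam : Rigid → Rigid
  app : Rigid → (n : ℕ) → Vec Rigid n → Rigid
  inl : Rigid → Rigid
  inr : Rigid → Rigid

data RigExp : Set where
  term : Rigid → RigExp
  mono : (n : ℕ) → Vec Rigid n → RigExp

-- r ↦ r̲ : replace recursively each list by the multiset of its elements
mutual
  ul : Rigid → RTm
  ul (var x) = var x
  ul (lam a) = lam (ul a)
  ul (app a n bs) = app (ul a) (ulV bs)
  ul (inl a) = inl (ul a)
  ul (inr a) = inr (ul a)

  ulV : ∀ {n} → Vec Rigid n → List RTm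
  ulV Vec.[] = []
  ulV (b Vec.∷ bs) = ul b ∷ ulV bs

ulE : RigExp → RExp
ulE (term a) = term (ul a)
ulE (mono n bs) = mono (ulV bs)

_◁_ : RigExp → RExp → Set
r ◁ e = ulE r ≈E e

-- Permutation expressions.  A permutation σ ∈ 𝔖ₙ is a vector of its
-- values σ(0),…,σ(n-1), required to be a bijection in the judgement.

mutual
  data Perm : Set where
    pid  : ℕ → Perm
    plam : Perm → Perm
    papp : Perm → PMono → Perm
    pinl : Perm → Perm
    pinr : Perm → Perm

  data PMono : Set where
    pmono : (n : ℕ) → Vec (Fin n) n → Vec Perm n → PMono

data PermExp : Set where
  term : Perm → PermExp
  mono : PMono → PermExp

IsPerm : ∀ {n} → Vec (Fin n) n → Set
IsPerm {n} σ = (∀ i j → lookup σ i ≡ lookup σ j → i ≡ j)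
             × (∀ j → ∃ λ i → lookup σ i ≡ j)

mutual
  data _∶_≅_ : Perm → Rigid → Rigid → Set where
    pid  : ∀ x → pid x ∶ var x ≅ var x
    plam : ∀ {α a a'} → α ∶ a ≅ a' → plam α ∶ lam a ≅ lam a'
    papp : ∀ {γ δ c c' n ds ds'} → γ ∶ c ≅ c' → δ ∶ₘ n , ds ≅ ds'
         → papp γ δ ∶ app c n ds ≅ app c' n ds'
    pinl : ∀ {α a a'} → α ∶ a ≅ a' → pinl α ∶ inl a ≅ inl a'
    pinr : ∀ {α a a'} → α ∶ a ≅ a' → pinr α ∶ inr a ≅ inr a'

  data _∶ₘ_,_≅_ : PMono → (n : ℕ) → Vec Rigid n → Vec Rigid n → Set where
    pmono : ∀ {n σ αs as as'} → IsPerm σ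
          → (∀ i → lookup αs i ∶ lookup as i ≅ lookup as' (lookup σ i))
          → pmono n σ αs ∶ₘ n , as ≅ as'

data _∶E_≅_ : PermExp → RigExp → RigExp → Set where
  term : ∀ {α a a'} → α ∶ a ≅ a' → term α ∶E term a ≅ term a'
  mono : ∀ {δ n ds ds'} → δ ∶ₘ n , ds ≅ ds' → mono δ ∶E mono n ds ≅ mono n ds'

𝔻 : RigExp → PermExp → Set
𝔻 r ε = ε ∶E r ≅ r

Card : {A : Set} → (A → Set) → ℕ → Set
Card {A} P k = Σ (Fin k → A) λ f →
    (∀ i j → f i ≡ f j → i ≡ j)
  × (∀ i → P (f i))
  × (∀ a → P a → ∃ λ i → f i ≡ a)

-- We prove a relative and stronger statement by induction on the derivation
-- of  m(s) = k :  for ANY two rigid expressions a, a' with  a̲ = a'̲ = s  there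
-- are exactly k permutation expressions  α : a ≅ a'  (𝔻(r) is the case a = a').
-- Constructors other than monomials are handled by the induction hypothesis
-- alone.  For a monomial, write its underlying multiset as pairwise distinct
-- blocks  [t₁]^{n₁}·…·[t_p]^{n_p}.  An isomorphism (σ, α₁, …, αₙ) between
-- (a₁, …, aₙ) and (a'₁, …, a'ₙ) is the same thing as a position j = σ(1),
-- an isomorphism α₁ : a₁ ≅ a'ⱼ, and an isomorphism between the two lists with
-- a₁ resp. a'ⱼ removed.  Isomorphic rigid terms have equal underlying terms, so
-- only the n₁ positions j with a'̲ⱼ = t₁ contribute, each m(t₁)·m(rest) times
-- (where "rest" is the multiset with one copy of t₁ removed); and indeed
-- n₁ · m(t₁) · m(rest) = m(whole), so induction on the length of the list
-- concludes.

module Submission where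

open import Defs
open import Level using (0ℓ)
open import Data.Nat using (ℕ; zero; suc; _+_; _*_; _≤_; z≤n; s≤s)
import Data.Nat as ℕ
open import Data.Nat.Properties using (+-identityʳ; *-identityˡ)
open import Data.Nat.Tactic.RingSolver using (solve-∀)
open import Algebra.Definitions.RawMonoid ℕ.+-0-rawMonoid using (sum)
open import Data.Fin using (Fin; zero; suc; punchIn; punchOut; _≟_)
open import Data.Fin.Properties
  using (+↔⊎; *↔×; suc-injective; punchIn-injective; punchInᵢ≢i; punchOut-injective;
         punchIn-punchOut; punchOut-punchIn; punchOut-cong)
open import Data.Vec as Vec using (Vec; []; _∷_; lookup; tabulate; removeAt)
open import Data.Vec.Properties
  using (lookup-map; lookup∘tabulate; tabulate∘lookup; tabulate-cong; removeAt-punchOut; ∷-injective)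
open import Data.List using (List; []; _∷_; _++_; replicate; length; filter)
open import Data.List.Properties using (filter-accept; filter-reject)
open import Data.List.Relation.Unary.All as All using (All; []; _∷_)
open import Data.List.Relation.Unary.Any as Any using (Any; here; there)
open import Data.List.Relation.Unary.Any.Properties using (lookup-result; ++⁻)
open import Data.List.Relation.Unary.AllPairs using (AllPairs; []; _∷_)
open import Data.List.Relation.Binary.Pointwise using (Pointwise; []; _∷_)
open import Data.Product as Product using (Σ; _×_; _,_; proj₁; proj₂; ∃; uncurry)
open import Data.Sum as Sum using (_⊎_; inj₁; inj₂; [_,_]′)
open import Data.Empty using (⊥-elim)
open import Function using (_∘_; _↔_; Inverse; Injective)
open import Relation.Nullary using (¬_; Dec; yes; no)
open import Relation.Binary.Bundles using (Setoid)
open import Relation.Binary.PropositionalEquality as Eq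
  using (_≡_; _≢_; refl; cong; cong₂; sym; subst)
open Eq.≡-Reasoning

mutual
  ≈-refl : ∀ {s} → s ≈ s
  ≈-refl {var x} = var x
  ≈-refl {lam s} = lam ≈-refl
  ≈-refl {app s ts} = app ≈-refl ≈ₗ-refl
  ≈-refl {inl s} = inl ≈-refl
  ≈-refl {inr s} = inr ≈-refl

  ≈ₗ-refl : ∀ {ts} → ts ≈ₗ ts
  ≈ₗ-refl {[]} = []
  ≈ₗ-refl {t ∷ ts} = ≈-refl ∷ ≈ₗ-refl

mutual
  ≈-sym : ∀ {s s'} → s ≈ s' → s' ≈ s
  ≈-sym (var x) = var x
  ≈-sym (lam p) = lam (≈-sym p)
  ≈-sym (app p q) = app (≈-sym p) (≈ₗ-sym q)
  ≈-sym (inl p) = inl (≈-sym p)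
  ≈-sym (inr p) = inr (≈-sym p)

  ≈ₗ-sym : ∀ {ts ts'} → ts ≈ₗ ts' → ts' ≈ₗ ts
  ≈ₗ-sym [] = []
  ≈ₗ-sym (p ∷ q) = ≈-sym p ∷ ≈ₗ-sym q
  ≈ₗ-sym (swap s t ts) = swap t s ts
  ≈ₗ-sym (trans p q) = trans (≈ₗ-sym q) (≈ₗ-sym p)

≈-trans : ∀ {s s' s''} → s ≈ s' → s' ≈ s'' → s ≈ s''
≈-trans (var x) (var .x) = var x
≈-trans (lam p) (lam q) = lam (≈-trans p q)
≈-trans (app p q) (app p' q') = app (≈-trans p p') (trans q q')
≈-trans (inl p) (inl q) = inl (≈-trans p q)
≈-trans (inr p) (inr q) = inr (≈-trans p q)

RTm-setoid : Setoid 0ℓ 0ℓ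
RTm-setoid = record
  { Carrier = RTm ; _≈_ = _≈_
  ; isEquivalence = record { refl = ≈-refl ; sym = ≈-sym ; trans = ≈-trans } }

open import Data.List.Relation.Binary.Permutation.Setoid RTm-setoid
  using (_↭_; prep; swap; ↭-refl; ↭-sym; ↭-trans; ↭-swap)
  renaming (refl to ↭-pointwise; trans to ↭-compose)
open import Data.List.Relation.Binary.Permutation.Setoid.Properties RTm-setoid
  using (¬x∷xs↭[]; ∈-resp-↭; xs↭ys⇒|xs|≡|ys|; ↭-shift; ++⁺ˡ; drop-∷;
         dropMiddleElement; filter⁺)
open import Data.List.Membership.Setoid RTm-setoid using (_∈_)
open import Data.List.Membership.Setoid.Properties using (∈-∃++)

≈ₗ⇒↭ : ∀ {ts ts'} → ts ≈ₗ ts' → ts ↭ ts'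
≈ₗ⇒↭ [] = ↭-refl
≈ₗ⇒↭ (p ∷ q) = prep p (≈ₗ⇒↭ q)
≈ₗ⇒↭ (swap s t ts) = ↭-swap s t ↭-refl
≈ₗ⇒↭ (trans p q) = ↭-trans (≈ₗ⇒↭ p) (≈ₗ⇒↭ q)

pointwise⇒≈ₗ : ∀ {ts ts'} → Pointwise _≈_ ts ts' → ts ≈ₗ ts'
pointwise⇒≈ₗ [] = []
pointwise⇒≈ₗ (p ∷ q) = p ∷ pointwise⇒≈ₗ q

↭⇒≈ₗ : ∀ {ts ts'} → ts ↭ ts' → ts ≈ₗ ts'
↭⇒≈ₗ (↭-pointwise p) = pointwise⇒≈ₗ p
↭⇒≈ₗ (prep p q) = p ∷ ↭⇒≈ₗ q
↭⇒≈ₗ (swap {xs} {ys} {x} {y} p p' q) = trans (swap x y xs) (p' ∷ (p ∷ ↭⇒≈ₗ q))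
↭⇒≈ₗ (↭-compose p q) = trans (↭⇒≈ₗ p) (↭⇒≈ₗ q)

-- Equality of resource terms is decidable (needed to group a multiset into
-- blocks and to count occurrences); for monomials one removes the first
-- element from both sides.
mutual
  _≈?_ : (s s' : RTm) → Dec (s ≈ s')
  var x ≈? var y with x ℕ.≟ y
  ... | yes refl = yes (var x)
  ... | no x≢y = no λ { (var _) → x≢y refl }
  lam s ≈? lam s' with s ≈? s'
  ... | yes p = yes (lam p)
  ... | no ¬p = no λ { (lam p) → ¬p p }
  app s ts ≈? app s' ts' with s ≈? s' | ts ↭? ts'
  ... | yes p | yes q = yes (app p (↭⇒≈ₗ q))
  ... | no ¬p | _ = no λ { (app p _) → ¬p p }
  ... | _ | no ¬q = no λ { (app _ q) → ¬q (≈ₗ⇒↭ q) }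
  inl s ≈? inl s' with s ≈? s'
  ... | yes p = yes (inl p)
  ... | no ¬p = no λ { (inl p) → ¬p p }
  inr s ≈? inr s' with s ≈? s'
  ... | yes p = yes (inr p)
  ... | no ¬p = no λ { (inr p) → ¬p p }
  var _ ≈? lam _ = no λ ()
  var _ ≈? app _ _ = no λ ()
  var _ ≈? inl _ = no λ ()
  var _ ≈? inr _ = no λ ()
  lam _ ≈? var _ = no λ ()
  lam _ ≈? app _ _ = no λ ()
  lam _ ≈? inl _ = no λ ()
  lam _ ≈? inr _ = no λ ()
  app _ _ ≈? var _ = no λ ()
  app _ _ ≈? lam _ = no λ ()
  app _ _ ≈? inl _ = no λ ()
  app _ _ ≈? inr _ = no λ ()
  inl _ ≈? var _ = no λ ()
  inl _ ≈? lam _ = no λ ()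
  inl _ ≈? app _ _ = no λ ()
  inl _ ≈? inr _ = no λ ()
  inr _ ≈? var _ = no λ ()
  inr _ ≈? lam _ = no λ ()
  inr _ ≈? app _ _ = no λ ()
  inr _ ≈? inl _ = no λ ()

  _∈?_ : (t : RTm) (ts : List RTm) → Dec (t ∈ ts)
  t ∈? [] = no λ ()
  t ∈? (s ∷ ts) with t ≈? s | t ∈? ts
  ... | yes p | _ = yes (here p)
  ... | no _ | yes q = yes (there q)
  ... | no ¬p | no ¬q = no λ { (here p) → ¬p p ; (there q) → ¬q q }

  _↭?_ : (ts ts' : List RTm) → Dec (ts ↭ ts')
  [] ↭? [] = yes ↭-refl
  [] ↭? (_ ∷ _) = no λ p → ¬x∷xs↭[] (↭-sym p)
  (t ∷ ts) ↭? ts' with t ∈? ts'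
  ... | no t∉ = no λ p → t∉ (∈-resp-↭ p (here ≈-refl))
  ... | yes t∈ with ∈-∃++ RTm-setoid t∈
  ...   | ys , zs , w , t≈w , ts'≋ with ts ↭? (ys ++ zs)
  ...     | yes p = yes (↭-trans (prep t≈w p)
                        (↭-trans (↭-sym (↭-shift ys zs)) (↭-sym (↭-pointwise ts'≋))))
  ...     | no ¬p = no λ q → ¬p (dropMiddleElement [] ys
                        (↭-trans (prep (≈-sym t≈w) ↭-refl) (↭-trans q (↭-pointwise ts'≋))))

ValidBlock : Block → Set
ValidBlock b = (1 ≤ blkN b) × MultT (blkTm b) (blkM b)

Distinct : List Block → Set
Distinct = AllPairs (λ b b' → ¬ (blkTm b ≈ blkTm b'))

record Grouping (ts : List RTm) : Set where
  field
    parts : List Block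
    ↭parts : ts ↭ blocksList parts
    distinct : Distinct parts
    valid : All ValidBlock parts

-- The last component records that the terms of the new blocks are
-- t and those of the old ones, which keeps the blocks distinct.
insertTerm : ∀ {t k} → MultT t k → (bs : List Block) → Distinct bs → All ValidBlock bs →
  Σ (List Block) λ bs' → (t ∷ blocksList bs ↭ blocksList bs') × Distinct bs' × All ValidBlock bs'
    × (∀ {Q : RTm → Set} → Q t → All (Q ∘ blkTm) bs → All (Q ∘ blkTm) bs')
insertTerm {t} {k} m [] [] [] =
  (t , 1 , k) ∷ [] , ↭-refl , [] ∷ [] , (s≤s z≤n , m) ∷ [] , λ qt _ → qt ∷ []
insertTerm {t} m ((u , n , l) ∷ bs) (u≉bs ∷ d) (vu ∷ v) with t ≈? u
... | yes t≈u = (u , suc n , l) ∷ bs , prep t≈u ↭-refl , u≉bs ∷ d , (s≤s z≤n , proj₂ vu) ∷ v ,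
                λ { _ (qu ∷ qs) → qu ∷ qs }
... | no t≉u with insertTerm m bs d v
...   | bs' , p , d' , v' , tags =
  (u , n , l) ∷ bs' ,
  ↭-trans (↭-sym (↭-shift (replicate n u) (blocksList bs))) (++⁺ˡ (replicate n u) p) ,
  tags (t≉u ∘ ≈-sym) u≉bs ∷ d' , vu ∷ v' ,
  λ { qt (qu ∷ qs) → qu ∷ tags qt qs }

grouping : (ts : List RTm) → All (λ t → ∃ (MultT t)) ts → Grouping ts
grouping [] [] = record { parts = [] ; ↭parts = ↭-refl ; distinct = [] ; valid = [] }
grouping (t ∷ ts) ((k , m) ∷ ms) =
  let open Grouping (grouping ts ms)
      bs' , p , d' , v' , _ = insertTerm m parts distinct valid
  in record { parts = bs' ; ↭parts = ↭-trans (prep ≈-refl ↭parts) p ; distinct = d' ; valid = v' }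

mutual
  multT : (s : RTm) → ∃ (MultT s)
  multT (var x) = 1 , var x
  multT (lam s) = Product.map₂ lam (multT s)
  multT (app s ts) = let k , ms = multT s ; l , mts = multM ts in k * l , app ms mts
  multT (inl s) = Product.map₂ inl (multT s)
  multT (inr s) = Product.map₂ inr (multT s)

  multM : (ts : List RTm) → ∃ (MultM ts)
  multM ts = let open Grouping (grouping ts (multAll ts))
             in blocksMult parts , blocks parts (↭⇒≈ₗ ↭parts) distinct valid

  multAll : (ts : List RTm) → All (λ t → ∃ (MultT t)) ts
  multAll [] = []
  multAll (t ∷ ts) = multT t ∷ multAll ts

multiplicity : (e : RExp) → ∃ (MultE e)
multiplicity (term s) = Product.map₂ term (multT s)
multiplicity (mono ts) = Product.map₂ mono (multM ts)

card-map : ∀ {A B : Set} {P : A → Set} {Q : B → Set} {k} (g : A → B) → Injective _≡_ _≡_ g →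
  (∀ {x} → P x → Q (g x)) → (∀ {y} → Q y → ∃ λ x → P x × g x ≡ y) → Card P k → Card Q k
card-map g g-inj g-sound g-complete (f , f-inj , f-sound , f-complete) =
  g ∘ f , (λ i j eq → f-inj i j (g-inj eq)) , (λ i → g-sound (f-sound i)) ,
  λ y qy → let x , px , gx≡y = g-complete qy ; i , fi≡x = f-complete x px
           in i , Eq.trans (cong g fi≡x) gx≡y

card-via : ∀ {I A : Set} {P : A → Set} {k} → Fin k ↔ I → (g : I → A) → Injective _≡_ _≡_ g →
  (∀ i → P (g i)) → (∀ a → P a → ∃ λ i → g i ≡ a) → Card P k
card-via e g g-inj g-sound g-complete =
  g ∘ to , (λ i j eq → to-injective (g-inj eq)) , g-sound ∘ to ,
  λ a pa → let i , gi≡a = g-complete a pa in from i , Eq.trans (cong g (strictlyInverseˡ i)) gi≡a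
  where
  open Inverse e
  to-injective : Injective _≡_ _≡_ to
  to-injective {i} {j} eq = Eq.trans (sym (strictlyInverseʳ i)) (Eq.trans (cong from eq) (strictlyInverseʳ j))

card-empty : ∀ {A : Set} {P : A → Set} → (∀ {a} → ¬ P a) → Card P 0
card-empty ¬P = (λ ()) , (λ ()) , (λ ()) , λ _ pa → ⊥-elim (¬P pa)

card-⊎ : ∀ {A B : Set} {P : A → Set} {Q : B → Set} {k l} → Card P k → Card Q l →
  Card [ P , Q ]′ (k + l)
card-⊎ {k = k} (f , f-inj , f-sound , f-complete) (g , g-inj , g-sound , g-complete) =
  card-via +↔⊎ (Sum.map f g) map-inj
    (λ { (inj₁ i) → f-sound i ; (inj₂ j) → g-sound j })
    (λ { (inj₁ a) pa → Product.map inj₁ (cong inj₁) (f-complete a pa)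
       ; (inj₂ b) qb → Product.map inj₂ (cong inj₂) (g-complete b qb) })
  where
  map-inj : Injective _≡_ _≡_ (Sum.map f g)
  map-inj {inj₁ i} {inj₁ j} eq = cong inj₁ (f-inj i j (cong [ (λ x → x) , (λ _ → f i) ]′ eq))
  map-inj {inj₂ i} {inj₂ j} eq = cong inj₂ (g-inj i j (cong [ (λ _ → g i) , (λ x → x) ]′ eq))
  map-inj {inj₁ _} {inj₂ _} ()
  map-inj {inj₂ _} {inj₁ _} ()

card-× : ∀ {A B : Set} {P : A → Set} {Q : B → Set} {k l} → Card P k → Card Q l →
  Card (λ x → P (proj₁ x) × Q (proj₂ x)) (k * l)
card-× (f , f-inj , f-sound , f-complete) (g , g-inj , g-sound , g-complete) =
  card-via *↔× (Product.map f g)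
    (λ { {i , j} {i' , j'} eq → cong₂ _,_ (f-inj i i' (cong proj₁ eq)) (g-inj j j' (cong proj₂ eq)) })
    (λ { (i , j) → f-sound i , g-sound j })
    (λ { (a , b) (pa , qb) → let i , fi≡a = f-complete a pa ; j , gj≡b = g-complete b qb
                             in (i , j) , cong₂ _,_ fi≡a gj≡b })

card-∑ : ∀ {B : Set} {m} (P : Fin m → B → Set) (c : Fin m → ℕ) → (∀ j → Card (P j) (c j)) →
  Card (uncurry P) (sum c)
card-∑ {m = zero} P c cards = card-empty λ { {() , _} }
card-∑ {B} {suc m} P c cards =
  card-map first-or-later first-or-later-injective (λ { {inj₁ _} p → p ; {inj₂ _} p → p })
    (λ { {zero , b} p → inj₁ b , p , refl ; {suc j , b} p → inj₂ (j , b) , p , refl })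
    (card-⊎ (cards zero) (card-∑ (P ∘ suc) (c ∘ suc) (cards ∘ suc)))
  where
  first-or-later : B ⊎ (Fin m × B) → Fin (suc m) × B
  first-or-later = [ (λ b → zero , b) , Product.map₁ suc ]′
  first-or-later-injective : Injective _≡_ _≡_ first-or-later
  first-or-later-injective {inj₁ _} {inj₁ _} refl = refl
  first-or-later-injective {inj₂ _} {inj₂ _} refl = refl

Isos : Rigid → Rigid → Perm → Set
Isos a a' α = α ∶ a ≅ a'

PermData : ℕ → Set
PermData n = Vec (Fin n) n × Vec Perm n

MonoIsos : ∀ {n} → Vec Rigid n → Vec Rigid n → PermData n → Set
MonoIsos as as' (σ , αs) = IsPerm σ × (∀ i → Isos (lookup as i) (lookup as' (lookup σ i)) (lookup αs i))

lookup-ext : ∀ {A : Set} {n} {xs ys : Vec A n} → (∀ i → lookup xs i ≡ lookup ys i) → xs ≡ ys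
lookup-ext {xs = xs} {ys} eq =
  Eq.trans (sym (tabulate∘lookup xs)) (Eq.trans (tabulate-cong eq) (tabulate∘lookup ys))

map-injective : ∀ {A B : Set} {n} {f : A → B} → Injective _≡_ _≡_ f → Injective _≡_ _≡_ (Vec.map {n = n} f)
map-injective f-inj {[]} {[]} refl = refl
map-injective f-inj {x ∷ xs} {y ∷ ys} eq =
  let x≡y , xs≡ys = ∷-injective eq in cong₂ _∷_ (f-inj x≡y) (map-injective f-inj xs≡ys)

lookup-removeAt : ∀ {A : Set} {n} (xs : Vec A (suc n)) j i →
  lookup (removeAt xs j) i ≡ lookup xs (punchIn j i)
lookup-removeAt xs j i =
  Eq.trans (cong (lookup (removeAt xs j)) (sym (punchOut-punchIn j {i})))
           (removeAt-punchOut xs (punchInᵢ≢i j i ∘ sym))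

isPerm-cons : ∀ {n} (j : Fin (suc n)) {σ : Vec (Fin n) n} → IsPerm σ → IsPerm (j ∷ Vec.map (punchIn j) σ)
isPerm-cons j {σ} (σ-inj , σ-sur) = inj , sur
  where
  at : ∀ i → lookup (Vec.map (punchIn j) σ) i ≡ punchIn j (lookup σ i)
  at i = lookup-map i (punchIn j) σ
  inj : ∀ i i' → lookup (j ∷ Vec.map (punchIn j) σ) i ≡ lookup (j ∷ Vec.map (punchIn j) σ) i' → i ≡ i'
  inj zero zero _ = refl
  inj zero (suc i') eq = ⊥-elim (punchInᵢ≢i j (lookup σ i') (sym (Eq.trans eq (at i'))))
  inj (suc i) zero eq = ⊥-elim (punchInᵢ≢i j (lookup σ i) (Eq.trans (sym (at i)) eq))
  inj (suc i) (suc i') eq =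
    cong suc (σ-inj i i' (punchIn-injective j _ _ (Eq.trans (sym (at i)) (Eq.trans eq (at i')))))
  sur : ∀ t → ∃ λ i → lookup (j ∷ Vec.map (punchIn j) σ) i ≡ t
  sur t with j ≟ t
  ... | yes j≡t = zero , j≡t
  ... | no j≢t = let i , σi≡ = σ-sur (punchOut j≢t)
                 in suc i , Eq.trans (at i) (Eq.trans (cong (punchIn j) σi≡) (punchIn-punchOut j≢t))

isPerm-uncons : ∀ {n} {j : Fin (suc n)} {τ : Vec (Fin (suc n)) n} → IsPerm (j ∷ τ) →
  Σ (Vec (Fin n) n) λ σ → IsPerm σ × Vec.map (punchIn j) σ ≡ τ
isPerm-uncons {n} {j} {τ} (τ-inj , τ-sur) = σ , (inj , sur) , lookup-ext extends
  where
  j≢ : ∀ i → j ≢ lookup τ i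
  j≢ i eq with τ-inj zero (suc i) eq
  ... | ()
  σ : Vec (Fin n) n
  σ = tabulate (λ i → punchOut (j≢ i))
  at : ∀ i → lookup σ i ≡ punchOut (j≢ i)
  at = lookup∘tabulate (λ i → punchOut (j≢ i))
  extends : ∀ i → lookup (Vec.map (punchIn j) σ) i ≡ lookup τ i
  extends i = Eq.trans (lookup-map i (punchIn j) σ) (Eq.trans (cong (punchIn j) (at i)) (punchIn-punchOut (j≢ i)))
  inj : ∀ i i' → lookup σ i ≡ lookup σ i' → i ≡ i'
  inj i i' eq = suc-injective (τ-inj (suc i) (suc i')
    (punchOut-injective (j≢ i) (j≢ i') (Eq.trans (sym (at i)) (Eq.trans eq (at i')))))
  sur : ∀ t → ∃ λ i → lookup σ i ≡ t
  sur t with τ-sur (punchIn j t)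
  ... | zero , j≡ = ⊥-elim (punchInᵢ≢i j t (sym j≡))
  ... | suc i , τi≡ = i , Eq.trans (at i) (Eq.trans (punchOut-cong j τi≡) (punchOut-punchIn j))

consPerm : ∀ {n} → Fin (suc n) × Perm × PermData n → PermData (suc n)
consPerm (j , α , σ , αs) = j ∷ Vec.map (punchIn j) σ , α ∷ αs

consPerm-injective : ∀ {n} → Injective _≡_ _≡_ (consPerm {n})
consPerm-injective {x = j , α , σ , αs} {j' , α' , σ' , αs'} eq
  with ∷-injective (cong proj₁ eq) | ∷-injective (cong proj₂ eq)
... | refl , punchIn∘σ≡ | refl , refl with map-injective (punchIn-injective j _ _) punchIn∘σ≡
... | refl = refl

ConsIsos : ∀ {n} → Rigid → Vec Rigid n → Vec Rigid (suc n) → Fin (suc n) → Perm × PermData n → Set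
ConsIsos a as as' j (α , τ) = Isos a (lookup as' j) α × MonoIsos as (removeAt as' j) τ

target-removeAt : ∀ {n} (as' : Vec Rigid (suc n)) j (σ : Vec (Fin n) n) i →
  lookup (removeAt as' j) (lookup σ i) ≡ lookup as' (lookup (Vec.map (punchIn j) σ) i)
target-removeAt as' j σ i =
  Eq.trans (lookup-removeAt as' j (lookup σ i)) (cong (lookup as') (sym (lookup-map i (punchIn j) σ)))

consPerm-sound : ∀ {n} a as as' {x : Fin (suc n) × Perm × PermData n} →
  uncurry (ConsIsos a as as') x → MonoIsos (a ∷ as) as' (consPerm x)
consPerm-sound a as as' {j , α , σ , αs} (a≅ , σ-perm , as≅) =
  isPerm-cons j σ-perm ,
  λ { zero → a≅ ; (suc i) → subst (λ target → Isos _ target _) (target-removeAt as' j σ i) (as≅ i) }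

consPerm-complete : ∀ {n} a as as' {τ : PermData (suc n)} → MonoIsos (a ∷ as) as' τ →
  ∃ λ x → uncurry (ConsIsos a as as') x × consPerm x ≡ τ
consPerm-complete a as as' {j ∷ τ , α ∷ αs} (perm , isos) with isPerm-uncons perm
... | σ , σ-perm , refl =
  (j , α , σ , αs) ,
  (isos zero , σ-perm , λ i → subst (λ target → Isos _ target _) (sym (target-removeAt as' j σ i)) (isos (suc i))) ,
  refl

card-by-first : ∀ {n k} a as (as' : Vec Rigid (suc n)) →
  Card (uncurry (ConsIsos a as as')) k → Card (MonoIsos (a ∷ as) as') k
card-by-first a as as' =
  card-map consPerm consPerm-injective (consPerm-sound a as as') (consPerm-complete a as as')

to-front : ∀ {n} (xs : Vec Rigid (suc n)) j → ulV xs ↭ ul (lookup xs j) ∷ ulV (removeAt xs j)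
to-front (x ∷ xs) zero = ↭-refl
to-front (x ∷ y ∷ xs) (suc j) =
  ↭-trans (prep ≈-refl (to-front (y ∷ xs) j)) (↭-swap (ul x) (ul (lookup (y ∷ xs) j)) ↭-refl)

mutual
  iso-ul : ∀ a {a' α} → α ∶ a ≅ a' → ul a ≈ ul a'
  iso-ul (var x) (pid x) = var x
  iso-ul (lam a) (plam i) = lam (iso-ul a i)
  iso-ul (app c n ds) (papp i (pmono {σ = σ} {αs} perm isos)) =
    app (iso-ul c i) (↭⇒≈ₗ (iso-ulV ds (σ , αs) (perm , isos)))
  iso-ul (inl a) (pinl i) = inl (iso-ul a i)
  iso-ul (inr a) (pinr i) = inr (iso-ul a i)

  iso-ulV : ∀ {n} (as : Vec Rigid n) {as'} τ → MonoIsos as as' τ → ulV as ↭ ulV as'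
  iso-ulV [] {[]} _ _ = ↭-refl
  iso-ulV (a ∷ as) {as'} τ isos with consPerm-complete a as as' {τ} isos
  ... | (j , _ , τ') , (a≅ , as≅) , _ = ↭-trans (prep (iso-ul a a≅) (iso-ulV as τ' as≅)) (↭-sym (to-front as' j))

Occurs : RTm → Block → Set
Occurs v b = v ≈ blkTm b × 1 ≤ blkN b

copy-occurs : ∀ n {v t} → v ∈ replicate n t → v ≈ t × 1 ≤ n
copy-occurs (suc n) (here v≈t) = v≈t , s≤s z≤n
copy-occurs (suc n) (there v∈) = proj₁ (copy-occurs n v∈) , s≤s z≤n

blockOf : ∀ {v} bs → v ∈ blocksList bs → Any (Occurs v) bs
blockOf ((t , n , k) ∷ bs) v∈ with ++⁻ (replicate n t) v∈
... | inj₁ v∈copies = here (copy-occurs n v∈copies)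
... | inj₂ v∈rest = there (blockOf bs v∈rest)

removeCopy : ∀ {v} bs → Any (Occurs v) bs → List Block
removeCopy ((t , n , k) ∷ bs) (here _) = (t , ℕ.pred n , k) ∷ bs
removeCopy (b ∷ bs) (there loc) = b ∷ removeCopy bs loc

blocksList-removeCopy : ∀ {v} bs (loc : Any (Occurs v) bs) →
  blocksList bs ↭ blkTm (Any.lookup loc) ∷ blocksList (removeCopy bs loc)
blocksList-removeCopy ((t , suc n , k) ∷ bs) (here _) = ↭-refl
blocksList-removeCopy ((t , n , k) ∷ bs) (there loc) =
  ↭-trans (++⁺ˡ (replicate n t) (blocksList-removeCopy bs loc)) (↭-shift (replicate n t) _)

blocksMult-removeCopy : ∀ {v} bs (loc : Any (Occurs v) bs) →
  blocksMult bs ≡ blkN (Any.lookup loc) * (blkM (Any.lookup loc) * blocksMult (removeCopy bs loc))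
blocksMult-removeCopy ((t , suc n , k) ∷ bs) (here _) =
  reassociate (suc n) (n ℕ.!) k (k ℕ.^ n) (blocksMult bs)
  where
  reassociate : ∀ s f k p r → s * f * (k * p) * r ≡ s * (k * (f * p * r))
  reassociate = solve-∀
blocksMult-removeCopy ((t , n , k) ∷ bs) (there loc) =
  Eq.trans (cong (n ℕ.! * k ℕ.^ n *_) (blocksMult-removeCopy bs loc)) 
    (commute (n ℕ.! * k ℕ.^ n) (blkN (Any.lookup loc)) (blkM (Any.lookup loc)) (blocksMult (removeCopy bs loc)))
  where
  commute : ∀ g n k r → g * (n * (k * r)) ≡ n * (k * (g * r))
  commute = solve-∀

All-removeCopy : ∀ {v} {P : Block → Set} → (∀ {t n n' k} → P (t , n , k) → P (t , n' , k)) →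
  ∀ {bs} (loc : Any (Occurs v) bs) → All P bs → All P (removeCopy bs loc)
All-removeCopy copies-irrelevant (here _) (pb ∷ pbs) = copies-irrelevant pb ∷ pbs
All-removeCopy copies-irrelevant (there loc) (pb ∷ pbs) = pb ∷ All-removeCopy copies-irrelevant loc pbs

Distinct-removeCopy : ∀ {v bs} (loc : Any (Occurs v) bs) → Distinct bs → Distinct (removeCopy bs loc)
Distinct-removeCopy (here _) (b≉ ∷ d) = b≉ ∷ d
Distinct-removeCopy (there loc) (b≉ ∷ d) = All-removeCopy (λ b≉b' → b≉b') loc b≉ ∷ Distinct-removeCopy loc d

occ : RTm → List RTm → ℕ
occ t₀ = length ∘ filter (_≈? t₀)

occ-↭ : ∀ t₀ {xs ys} → xs ↭ ys → occ t₀ xs ≡ occ t₀ ys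
occ-↭ t₀ p = xs↭ys⇒|xs|≡|ys| (filter⁺ (_≈? t₀) (λ x≈y x≈t₀ → ≈-trans (≈-sym x≈y) x≈t₀) p)

occ-copies≈ : ∀ {t t₀} → t ≈ t₀ → ∀ n R → occ t₀ (replicate n t ++ R) ≡ n + occ t₀ R
occ-copies≈ t≈t₀ zero R = refl
occ-copies≈ {t₀ = t₀} t≈t₀ (suc n) R =
  Eq.trans (cong length (filter-accept (_≈? t₀) t≈t₀)) (cong suc (occ-copies≈ t≈t₀ n R))

occ-copies≉ : ∀ {t t₀} → ¬ t ≈ t₀ → ∀ n R → occ t₀ (replicate n t ++ R) ≡ occ t₀ R
occ-copies≉ t≉t₀ zero R = refl
occ-copies≉ {t₀ = t₀} t≉t₀ (suc n) R =
  Eq.trans (cong length (filter-reject (_≈? t₀) t≉t₀)) (occ-copies≉ t≉t₀ n R)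

occ-absent : ∀ {t₀} bs → All (λ b → ¬ blkTm b ≈ t₀) bs → occ t₀ (blocksList bs) ≡ 0
occ-absent [] [] = refl
occ-absent ((t , n , k) ∷ bs) (t≉t₀ ∷ bs≉t₀) = Eq.trans (occ-copies≉ t≉t₀ n _) (occ-absent bs bs≉t₀)

occ-blocksList : ∀ {v} bs (loc : Any (Occurs v) bs) → Distinct bs →
  occ (blkTm (Any.lookup loc)) (blocksList bs) ≡ blkN (Any.lookup loc)
occ-blocksList ((t , n , k) ∷ bs) (here _) (t≉ ∷ _) = begin
  occ t (replicate n t ++ blocksList bs) ≡⟨ occ-copies≈ ≈-refl n _ ⟩
  n + occ t (blocksList bs)             ≡⟨ cong (n +_) (occ-absent bs (All.map (_∘ ≈-sym) t≉)) ⟩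
  n + 0                                 ≡⟨ +-identityʳ n ⟩
  n                                     ∎
occ-blocksList ((t , n , k) ∷ bs) (there loc) (t≉ ∷ d) =
  Eq.trans (occ-copies≉ (proj₁ (All.lookupAny t≉ loc)) n _) (occ-blocksList bs loc d)

_when_ : ∀ {P : Set} → ℕ → Dec P → ℕ
K when yes _ = K
K when no _ = 0

occ-positions : ∀ t₀ K {n} (xs : Vec Rigid n) →
  sum (λ j → K when (ul (lookup xs j) ≈? t₀)) ≡ occ t₀ (ulV xs) * K
occ-positions t₀ K [] = refl
occ-positions t₀ K (x ∷ xs) with ul x ≈? t₀
... | yes _ = cong (K +_) (occ-positions t₀ K xs)
... | no _ = occ-positions t₀ K xs

blocksMult-nil : ∀ bs → [] ↭ blocksList bs → blocksMult bs ≡ 1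
blocksMult-nil [] _ = refl
blocksMult-nil ((t , zero , k) ∷ bs) p = Eq.trans (*-identityˡ _) (blocksMult-nil bs p)
blocksMult-nil ((t , suc n , k) ∷ bs) p = ⊥-elim (¬x∷xs↭[] (↭-sym p))

CountsIsos : Block → Set
CountsIsos b = ∀ a a' → ul a ≈ blkTm b → ul a' ≈ blkTm b → Card (Isos a a') (blkM b)

card-nil : Card (MonoIsos [] []) 1
card-nil = (λ _ → [] , []) , (λ { zero zero _ → refl }) , (λ _ → ((λ ()) , (λ ())) , (λ ())) ,
           λ { ([] , []) _ → zero , refl }

mono-count : ∀ {n} bs → Distinct bs → All CountsIsos bs → (as as' : Vec Rigid n) →
  ulV as ↭ blocksList bs → ulV as' ↭ blocksList bs → Card (MonoIsos as as') (blocksMult bs)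
mono-count bs _ _ [] [] p _ = subst (Card _) (sym (blocksMult-nil bs p)) card-nil
mono-count {suc n} bs d counts (a ∷ as) as' p p' =
  subst (Card _) total (card-by-first a as as' (card-∑ (ConsIsos a as as') choices per-choice))
  where
  loc : Any (Occurs (ul a)) bs
  loc = blockOf bs (∈-resp-↭ p (here ≈-refl))
  t₀ : RTm
  t₀ = blkTm (Any.lookup loc)
  a≈t₀ : ul a ≈ t₀
  a≈t₀ = proj₁ (lookup-result loc)
  rest : List Block
  rest = removeCopy bs loc
  K : ℕ
  K = blkM (Any.lookup loc) * blocksMult rest
  choices : Fin (suc n) → ℕ
  choices j = K when (ul (lookup as' j) ≈? t₀)
  removing : ∀ {x xs} → x ∷ xs ↭ blocksList bs → x ≈ t₀ → xs ↭ blocksList rest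
  removing q x≈t₀ = drop-∷ (↭-trans (prep (≈-sym x≈t₀) ↭-refl) (↭-trans q (blocksList-removeCopy bs loc)))
  per-choice : ∀ j → Card (ConsIsos a as as' j) (choices j)
  per-choice j with ul (lookup as' j) ≈? t₀
  ... | yes a'ⱼ≈t₀ =
    card-× (proj₁ (All.lookupAny counts loc) a (lookup as' j) a≈t₀ a'ⱼ≈t₀)
           (mono-count rest (Distinct-removeCopy loc d) (All-removeCopy (λ c → c) loc counts)
              as (removeAt as' j) (removing p a≈t₀) (removing (↭-trans (↭-sym (to-front as' j)) p') a'ⱼ≈t₀))
  ... | no a'ⱼ≉t₀ = card-empty λ { (a≅ , _) → a'ⱼ≉t₀ (≈-trans (≈-sym (iso-ul a a≅)) a≈t₀) }
  total : sum choices ≡ blocksMult bs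
  total = begin
    sum choices                         ≡⟨ occ-positions t₀ K as' ⟩
    occ t₀ (ulV as') * K                ≡⟨ cong (_* K) (occ-↭ t₀ p') ⟩
    occ t₀ (blocksList bs) * K          ≡⟨ cong (_* K) (occ-blocksList bs loc d) ⟩
    blkN (Any.lookup loc) * K           ≡⟨ sym (blocksMult-removeCopy bs loc) ⟩
    blocksMult bs                       ∎

length-ulV : ∀ {n} (ds : Vec Rigid n) → length (ulV ds) ≡ n
length-ulV [] = refl
length-ulV (d ∷ ds) = cong suc (length-ulV ds)

same-length : ∀ {n n'} (ds : Vec Rigid n) (ds' : Vec Rigid n') → ulV ds ↭ ulV ds' → n ≡ n'
same-length ds ds' p = Eq.trans (sym (length-ulV ds)) (Eq.trans (xs↭ys⇒|xs|≡|ys| p) (length-ulV ds'))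

card-pid : ∀ x → Card (Isos (var x) (var x)) 1
card-pid x = (λ _ → pid x) , (λ { zero zero _ → refl }) , (λ _ → pid x) , λ { _ (pid _) → zero , refl }

mutual
  term-count : ∀ {s k} → MultT s k → ∀ a a' → ul a ≈ s → ul a' ≈ s → Card (Isos a a') k
  term-count (var x) (var _) (var _) (var _) (var _) = card-pid x
  term-count (lam m) (lam a) (lam a') (lam p) (lam p') =
    card-map plam (λ { refl → refl }) plam (λ { (plam i) → _ , i , refl }) (term-count m a a' p p')
  term-count (inl m) (inl a) (inl a') (inl p) (inl p') =
    card-map pinl (λ { refl → refl }) pinl (λ { (pinl i) → _ , i , refl }) (term-count m a a' p p')
  term-count (inr m) (inr a) (inr a') (inr p) (inr p') =
    card-map pinr (λ { refl → refl }) pinr (λ { (pinr i) → _ , i , refl }) (term-count m a a' p p')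
  term-count (app m mm) (app c n ds) (app c' n' ds') (app p ps) (app p' ps')
    with same-length ds ds' (↭-trans (≈ₗ⇒↭ ps) (↭-sym (≈ₗ⇒↭ ps')))
  ... | refl =
    card-map (uncurry papp) (λ { refl → refl }) (uncurry papp) (λ { (papp i j) → _ , (i , j) , refl })
      (card-× (term-count m c c' p p') (monomial-count mm ds ds' ps ps'))

  monomial-count : ∀ {ts k} → MultM ts k → ∀ {n} (as as' : Vec Rigid n) →
    ulV as ≈ₗ ts → ulV as' ≈ₗ ts → Card (λ δ → δ ∶ₘ n , as ≅ as') k
  monomial-count (blocks bs ts≈ d v) as as' p p' =
    card-map (uncurry (pmono _)) (λ { refl → refl }) (uncurry pmono) (λ { (pmono i j) → _ , (i , j) , refl })
      (mono-count bs d (blocks-count v) as as' (≈ₗ⇒↭ (trans p ts≈)) (≈ₗ⇒↭ (trans p' ts≈)))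

  blocks-count : ∀ {bs} → All ValidBlock bs → All CountsIsos bs
  blocks-count [] = []
  blocks-count ((_ , m) ∷ v) = term-count m ∷ blocks-count v

isomorphism-count : ∀ {e r r' k} → r ◁ e → r' ◁ e → MultE e k → Card (λ ε → ε ∶E r ≅ r') k
isomorphism-count {r = term a} {term a'} (term p) (term p') (term m) =
  card-map term (λ { refl → refl }) term (λ { (term i) → _ , i , refl }) (term-count m a a' p p')
isomorphism-count {r = mono n as} {mono n' as'} (mono p) (mono p') (mono mm)
  with same-length as as' (↭-trans (≈ₗ⇒↭ p) (↭-sym (≈ₗ⇒↭ p')))
... | refl = card-map mono (λ { refl → refl }) mono (λ { (mono i) → _ , i , refl }) (monomial-count mm as as' p p')

lemma5p3 : (e : RExp) (r : RigExp) → r ◁ e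
         → (∃ λ k → MultE e k) × (∀ k → MultE e k → Card (𝔻 r) k)
lemma5p3 e r r◁e = multiplicity e , λ k m → isomorphism-count r◁e r◁e m
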